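{- Let $\{D_I\}_{I\in\binom{[n]}{2}}$ be a family of positive real numbers satisfying the triangle inequalities, and let $x,y\in[n]$ be such that $D_{x,y}=\min_{1\le i<j\le n}D_{i,j}$. Define $$X=\{x\}\cup\{i\in[n]\setminus\{x,y\}:\ \exists\, j_1,\dots,j_t\in[n],\ t\text{ odd, with } D_{x,i}=D_{x,j_1}+D_{j_1,j_2}+\dots+D_{j_t,i}\text{ and all summands indecomposable}\},$$ $$Y=\{i\in[n]\setminus\{x\}:\ D_{x,i}\text{ is indecomposable, or }\exists\, j_1,\dots,j_t\in[n],\ t\text{ even, with } D_{x,i}=D_{x,j_1}+\dots+D_{j_t,i}\text{ and all summands indecomposable}\}.$$ Then the family is bigraphlike (on some pair of subsets of $[n]$) if and only if: (1) $X\cap Y=\emptyset$; and (2) for any distinct $a,b\in X$ there exists $z\in Y$ with $D_{a,b}=D_{a,z}+D_{z,b}$, and for any distinct $a,b\in Y$ there exists $z\in X$ with $D_{a,b}=D_{a,z}+D_{z,b}$.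
   Context: Write $D_{i,j}=D_{\{i,j\}}$. Triangle inequalities: $D_{i,j}\le D_{i,k}+D_{k,j}$ for distinct $i,j,k$. $D_{i,j}$ is indecomposable if $D_{i,j}<D_{i,z}+D_{z,j}$ for all $z\in[n]\setminus\{i,j\}$. A graph $B$ (finite, simple, connected) is bipartite on $X',Y'\subseteq V(B)$ if $X'\cap Y'=\emptyset$, $X'\cup Y'=V(B)$ and every edge joins $X'$ to $Y'$. A positive-weighted graph $\mathcal G=(G,w)$ has $w:E(G)\to\mathbb R_{>0}$, and $D_{i,j}(\mathcal G)$ is the minimum total weight of a path from $i$ to $j$. The family is bigraphlike on $X',Y'$ if there is a positive-weighted bipartite graph $\mathcal B=(B,w)$ on $X',Y'$ with $V(B)=[n]$ such that $D_{i,j}(\mathcal B)=D_{i,j}$ for all distinct $i,j$. -}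

module Defs where

open import Level using (0ℓ)
open import Data.Nat using (ℕ; _%_)
open import Data.Fin using (Fin)
open import Data.List using (List; []; _∷_; length)
open import Data.Product using (Σ; ∃; ∃-syntax; _×_; _,_)
open import Data.Sum using (_⊎_)
open import Data.Empty using (⊥)
open import Relation.Nullary using (¬_)
open import Relation.Binary.PropositionalEquality using (_≡_; _≢_)
open import Relation.Binary.Definitions using (Trichotomous)
open import Data.List.Relation.Unary.Unique.Propositional using (Unique)

-- The real numbers, axiomatised as a Dedekind-complete ordered field.
-- (agda-stdlib has no reals; every model of this record is, classically,
-- isomorphic to ℝ.)  Equality is propositional equality.

record Reals : Set₁ where
  infixl 6 _+_
  infixl 7 _*_
  infix 4 _<_ _≤_
  field
    ℝ   : Set
    _+_ _*_ : ℝ → ℝ → ℝ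
    -_  : ℝ → ℝ
    0r 1r : ℝ
    _<_ : ℝ → ℝ → Set
    +-assoc : ∀ a b c → (a + b) + c ≡ a + (b + c)
    +-comm  : ∀ a b → a + b ≡ b + a
    +-idˡ   : ∀ a → 0r + a ≡ a
    +-invˡ  : ∀ a → (- a) + a ≡ 0r
    *-assoc : ∀ a b c → (a * b) * c ≡ a * (b * c)
    *-comm  : ∀ a b → a * b ≡ b * a
    *-idˡ   : ∀ a → 1r * a ≡ a
    *-inv   : ∀ a → a ≢ 0r → ∃[ b ] (b * a ≡ 1r)
    distribˡ : ∀ a b c → a * (b + c) ≡ a * b + a * c
    0≢1     : 0r ≢ 1r
    <-irrefl : ∀ a → ¬ (a < a)
    <-trans  : ∀ {a b c} → a < b → b < c → a < c
    <-cmp    : Trichotomous _≡_ _<_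
    +-mono-< : ∀ {a b} c → a < b → a + c < b + c
    *-pos    : ∀ {a b} → 0r < a → 0r < b → 0r < a * b
    sup : (P : ℝ → Set) → ∃[ a ] P a → ∃[ u ] (∀ a → P a → ¬ (u < a)) →
          ∃[ s ] ((∀ a → P a → ¬ (s < a)) × (∀ u → (∀ a → P a → ¬ (u < a)) → ¬ (u < s)))

  _≤_ : ℝ → ℝ → Set
  a ≤ b = a < b ⊎ a ≡ b

module _ (R : Reals) where
  open Reals R

  -- A family {D_I}, I ∈ ([n] choose 2), is encoded as a symmetric function
  -- Fin n → Fin n → ℝ; its values on the diagonal are never used.

  Symmetric : {n : ℕ} → (Fin n → Fin n → ℝ) → Set
  Symmetric D = ∀ i j → i ≢ j → D i j ≡ D j i

  Positive : {n : ℕ} → (Fin n → Fin n → ℝ) → Set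
  Positive D = ∀ i j → i ≢ j → 0r < D i j

  TriangleInequalities : {n : ℕ} → (Fin n → Fin n → ℝ) → Set
  TriangleInequalities D =
    ∀ i j k → i ≢ j → j ≢ k → i ≢ k → D i j ≤ D i k + D k j

  Indecomposable : {n : ℕ} → (Fin n → Fin n → ℝ) → Fin n → Fin n → Set
  Indecomposable D i j = ∀ z → z ≢ i → z ≢ j → D i j < D i z + D z j

  chainSum : {n : ℕ} → (Fin n → Fin n → ℝ) → Fin n → List (Fin n) → Fin n → ℝ
  chainSum D a []       b = D a b
  chainSum D a (j ∷ js) b = D a j + chainSum D j js b

  AllIndecomposable : {n : ℕ} → (Fin n → Fin n → ℝ) → Fin n → List (Fin n) → Fin n → Set
  AllIndecomposable D a []       b = a ≢ b × Indecomposable D a b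
  AllIndecomposable D a (j ∷ js) b = a ≢ j × Indecomposable D a j × AllIndecomposable D j js b

  IndecChain : {n : ℕ} → (Fin n → Fin n → ℝ) → ℕ → Fin n → Fin n → Set
  IndecChain D parity x i =
    ∃[ js ] (length js % 2 ≡ parity × D x i ≡ chainSum D x js i × AllIndecomposable D x js i)

  InX : {n : ℕ} → (Fin n → Fin n → ℝ) → Fin n → Fin n → Fin n → Set
  InX D x y i = i ≡ x ⊎ (i ≢ x × i ≢ y × IndecChain D 1 x i)

  InY : {n : ℕ} → (Fin n → Fin n → ℝ) → Fin n → Fin n → Set
  InY D x i = i ≢ x × (Indecomposable D x i ⊎ IndecChain D 0 x i)

  record WeightedGraph (n : ℕ) : Set₁ where
    field
      Edge     : Fin n → Fin n → Set
      edge-sym : ∀ {i j} → Edge i j → Edge j i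
      loopless : ∀ {i} → ¬ Edge i i
      w        : Fin n → Fin n → ℝ          -- weight, only used on edges
      w-sym    : ∀ {i j} → Edge i j → w i j ≡ w j i
      w-pos    : ∀ {i j} → Edge i j → 0r < w i j

  module _ {n : ℕ} (G : WeightedGraph n) where
    open WeightedGraph G

    -- a walk i = v0, v1, ..., vk, j given by its interior vertices
    IsWalk : Fin n → List (Fin n) → Fin n → Set
    IsWalk a []       b = Edge a b
    IsWalk a (v ∷ vs) b = Edge a v × IsWalk v vs b

    walkWeight : Fin n → List (Fin n) → Fin n → ℝ
    walkWeight a []       b = w a b
    walkWeight a (v ∷ vs) b = w a v + walkWeight v vs b

    IsPath : Fin n → List (Fin n) → Fin n → Set
    IsPath a vs b = IsWalk a vs b × Unique (a ∷ vs Data.List.++ (b ∷ []))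

    Connected : Set
    Connected = ∀ a b → a ≢ b → ∃[ vs ] IsPath a vs b

    IsDistance : Fin n → Fin n → ℝ → Set
    IsDistance a b d =
      (∃[ vs ] (IsPath a vs b × walkWeight a vs b ≡ d)) ×
      (∀ vs → IsPath a vs b → d ≤ walkWeight a vs b)

  BipartiteOn : {n : ℕ} → WeightedGraph n → (Fin n → Set) → (Fin n → Set) → Set
  BipartiteOn G X' Y' =
    (∀ i → ¬ (X' i × Y' i)) ×
    (∀ i → X' i ⊎ Y' i) ×
    (∀ i j → WeightedGraph.Edge G i j → (X' i × Y' j) ⊎ (Y' i × X' j))

  BigraphlikeOn : {n : ℕ} → (Fin n → Fin n → ℝ) → (Fin n → Set) → (Fin n → Set) → Set₁
  BigraphlikeOn {n} D X' Y' =
    ∃[ B ] (Connected B × BipartiteOn B X' Y' ×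
            (∀ i j → i ≢ j → IsDistance B i j (D i j)))

  Bigraphlike : {n : ℕ} → (Fin n → Fin n → ℝ) → Set₁
  Bigraphlike {n} D = ∃[ X' ] ∃[ Y' ] BigraphlikeOn {n} D X' Y'

  Conditions : {n : ℕ} → (Fin n → Fin n → ℝ) → Fin n → Fin n → Set
  Conditions D x y =
    (∀ i → ¬ (InX D x y i × InY D x i)) ×
    (∀ a b → a ≢ b → InX D x y a → InX D x y b →
       ∃[ z ] (InY D x z × D a b ≡ D a z + D z b)) ×
    (∀ a b → a ≢ b → InY D x a → InY D x b →
       ∃[ z ] (InX D x y z × D a b ≡ D a z + D z b))

module Submission where

-- Splitting recursively, every D_{a,b} is the total of a tight chain of indecomposable pairs,
-- and a tight chain never repeats a vertex.  If a bipartite graph B realises D, every indecomposable pair is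
-- an edge of B (a shortest path through an interior vertex v would split it), so indecomposable
-- chains alternate sides: X lies on the side of x, Y on the other side, and for a, b on one side
-- the first step of an indecomposable chain from a to b is the midpoint required by (2).
-- Conversely, under (1) and (2) the graph of indecomposable pairs weighted by D realises D, and
-- (2) rules out an indecomposable pair inside X or inside Y.  Minimality of D_{x,y} is used only
-- to make D_{x,y} indecomposable, which puts y in Y and makes X ∪ Y everything.

open import Defs
open import Data.Bool using (Bool; true; false; not)
open import Data.Bool.Properties using (not-involutive)
open import Data.Empty using (⊥-elim)
open import Data.Fin using (Fin; _≟_)
open import Data.Fin.Properties using (any?)
open import Data.List using (List; []; _∷_; length; _++_; allFin; cartesianProduct)
open import Data.List.Membership.Propositional using (_∈_; _∉_)
open import Data.List.Membership.Propositional.Properties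
  using (∈-∃++; ∈-++⁻; ∈-++⁺ʳ; ∈-allFin; ∈-cartesianProduct⁺)
open import Data.List.Relation.Unary.All using ([]; _∷_; lookup)
open import Data.List.Relation.Unary.All.Properties using (¬Any⇒All¬)
open import Data.List.Relation.Unary.AllPairs using ([]; _∷_)
open import Data.List.Relation.Unary.Any using (here; there)
open import Data.List.Relation.Unary.Unique.Propositional using (Unique)
open import Data.Nat using (ℕ; zero; suc; _%_; z≤n; s≤s) renaming (_<_ to _<ℕ_; _≤_ to _≤ℕ_)
import Data.Nat.Properties as ℕ
open import Data.Product using (∃-syntax; _×_; _,_; proj₁; proj₂)
open import Data.Sum using (_⊎_; inj₁; inj₂)
open import Relation.Nullary using (¬_; Dec; yes; no)
open import Relation.Nullary.Decidable using (_×-dec_; ¬?)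
open import Relation.Binary.Consequences using (tri⇒dec<)
open import Relation.Binary.Definitions using (tri<; tri≈; tri>)
open import Relation.Binary.PropositionalEquality
  using (_≡_; _≢_; refl; sym; trans; cong; cong₂; subst; subst₂; ≢-sym; resp₂; isEquivalence; module ≡-Reasoning)
import Relation.Binary.Construct.StrictToNonStrict as StrictToNonStrict

module RealOrder (R : Reals) where
  open Reals R
  private module NonStrict = StrictToNonStrict _≡_ _<_

  ≤-refl : ∀ {a} → a ≤ a
  ≤-refl = NonStrict.reflexive refl

  ≤-trans : ∀ {a b c} → a ≤ b → b ≤ c → a ≤ c
  ≤-trans = NonStrict.trans isEquivalence (resp₂ _<_) <-trans

  <-≤-trans : ∀ {a b c} → a < b → b ≤ c → a < c
  <-≤-trans = NonStrict.<-≤-trans <-trans (proj₁ (resp₂ _<_))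

  ≤-<-trans : ∀ {a b c} → a ≤ b → b < c → a < c
  ≤-<-trans = NonStrict.≤-<-trans sym <-trans (proj₂ (resp₂ _<_))

  ≤-antisym : ∀ {a b} → a ≤ b → b ≤ a → a ≡ b
  ≤-antisym = NonStrict.antisym isEquivalence <-trans λ { refl → <-irrefl _ }

  ≤⇒≯ : ∀ {a b} → a ≤ b → ¬ (b < a)
  ≤⇒≯ a≤b b<a = <-irrefl _ (≤-<-trans a≤b b<a)

  ≮⇒≥ : ∀ {a b} → ¬ (a < b) → b ≤ a
  ≮⇒≥ {a} {b} a≮b with <-cmp a b
  ... | tri< a<b _ _ = ⊥-elim (a≮b a<b)
  ... | tri≈ _ a≡b _ = inj₂ (sym a≡b)
  ... | tri> _ _ b<a = inj₁ b<a

  _<?_ : ∀ a b → Dec (a < b)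
  _<?_ = tri⇒dec< <-cmp

  +-monoʳ-< : ∀ c {a b} → a < b → c + a < c + b
  +-monoʳ-< c a<b = subst₂ _<_ (+-comm _ c) (+-comm _ c) (+-mono-< c a<b)

  +-monoˡ-≤ : ∀ c {a b} → a ≤ b → a + c ≤ b + c
  +-monoˡ-≤ c (inj₁ a<b) = inj₁ (+-mono-< c a<b)
  +-monoˡ-≤ c (inj₂ refl) = ≤-refl

  +-monoʳ-≤ : ∀ c {a b} → a ≤ b → c + a ≤ c + b
  +-monoʳ-≤ c (inj₁ a<b) = inj₁ (+-monoʳ-< c a<b)
  +-monoʳ-≤ c (inj₂ refl) = ≤-refl

  +-mono-≤ : ∀ {a b c d} → a ≤ b → c ≤ d → a + c ≤ b + d
  +-mono-≤ {b = b} {c} a≤b c≤d = ≤-trans (+-monoˡ-≤ c a≤b) (+-monoʳ-≤ b c≤d)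

  x<y+x : ∀ x {y} → 0r < y → x < y + x
  x<y+x x {y} 0<y = subst (_< y + x) (+-idˡ x) (+-mono-< x 0<y)

  x<x+y : ∀ x {y} → 0r < y → x < x + y
  x<x+y x 0<y = subst (x <_) (+-comm _ x) (x<y+x x 0<y)

  +-pos : ∀ {a b} → 0r < a → 0r < b → 0r < a + b
  +-pos {a} 0<a 0<b = <-trans 0<a (x<x+y a 0<b)

module Chains (R : Reals) {n : ℕ} (D : Fin n → Fin n → Reals.ℝ R)
              (D-pos : Positive R D) (D-tri : TriangleInequalities R D) where
  open Reals R
  open RealOrder R

  AdjacentDistinct : Fin n → List (Fin n) → Fin n → Set
  AdjacentDistinct a []       b = a ≢ b
  AdjacentDistinct a (j ∷ js) b = a ≢ j × AdjacentDistinct j js b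

  allIndecomposable⇒adjacentDistinct : ∀ a js b →
    AllIndecomposable R D a js b → AdjacentDistinct a js b
  allIndecomposable⇒adjacentDistinct a []       b (a≢b , _) = a≢b
  allIndecomposable⇒adjacentDistinct a (j ∷ js) b (a≢j , _ , rest) =
    a≢j , allIndecomposable⇒adjacentDistinct j js b rest

  adjacentDistinct-++⁻ : ∀ a xs c ys b → AdjacentDistinct a (xs ++ c ∷ ys) b →
    AdjacentDistinct a xs c × AdjacentDistinct c ys b
  adjacentDistinct-++⁻ a []       c ys b (a≢c , rest) = a≢c , rest
  adjacentDistinct-++⁻ a (x ∷ xs) c ys b (a≢x , rest) =
    let left , right = adjacentDistinct-++⁻ x xs c ys b rest in (a≢x , left) , right

  allIndecomposable-++ : ∀ a xs c ys b →
    AllIndecomposable R D a xs c → AllIndecomposable R D c ys b →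
    AllIndecomposable R D a (xs ++ c ∷ ys) b
  allIndecomposable-++ a []       c ys b (a≢c , ind)       right = a≢c , ind , right
  allIndecomposable-++ a (x ∷ xs) c ys b (a≢x , ind , left) right =
    a≢x , ind , allIndecomposable-++ x xs c ys b left right

  chainSum-++ : ∀ a xs c ys b →
    chainSum R D a (xs ++ c ∷ ys) b ≡ chainSum R D a xs c + chainSum R D c ys b
  chainSum-++ a []       c ys b = refl
  chainSum-++ a (x ∷ xs) c ys b = trans (cong (D a x +_) (chainSum-++ x xs c ys b)) (sym (+-assoc _ _ _))

  chainSum-pos : ∀ a js b → AdjacentDistinct a js b → 0r < chainSum R D a js b
  chainSum-pos a []       b a≢b         = D-pos a b a≢b
  chainSum-pos a (j ∷ js) b (a≢j , rest) = +-pos (D-pos a j a≢j) (chainSum-pos j js b rest)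

  D≤chainSum : ∀ a js b → a ≢ b → AdjacentDistinct a js b → D a b ≤ chainSum R D a js b
  D≤chainSum a []       b _   _            = ≤-refl
  D≤chainSum a (j ∷ js) b a≢b (a≢j , rest) with j ≟ b
  ... | yes refl = inj₁ (x<x+y (D a j) (chainSum-pos j js j rest))
  ... | no j≢b   = ≤-trans (D-tri a b j a≢b (≢-sym j≢b) a≢j)
                           (+-monoʳ-≤ (D a j) (D≤chainSum j js b j≢b rest))

  Tight : Fin n → List (Fin n) → Fin n → Set
  Tight a js b = D a b ≡ chainSum R D a js b

  tight⇒second≢last : ∀ a j js b → AdjacentDistinct a (j ∷ js) b →
    Tight a (j ∷ js) b → j ≢ b
  tight⇒second≢last a j js b (_ , rest) tight refl =
    <-irrefl _ (subst (D a j <_) (sym tight) (x<x+y (D a j) (chainSum-pos j js j rest)))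

  tight-suffix : ∀ a j js b → a ≢ b → AdjacentDistinct a (j ∷ js) b →
    Tight a (j ∷ js) b → Tight j js b
  tight-suffix a j js b a≢b ad@(a≢j , rest) tight =
    ≤-antisym (D≤chainSum j js b j≢b rest) (≮⇒≥ shorter-suffix-impossible)
    where
    j≢b : j ≢ b
    j≢b = tight⇒second≢last a j js b ad tight
    shorter-suffix-impossible : ¬ (D j b < chainSum R D j js b)
    shorter-suffix-impossible D<sum =
      ≤⇒≯ (D-tri a b j a≢b (≢-sym j≢b) a≢j)
          (subst (D a j + D j b <_) (sym tight) (+-monoʳ-< (D a j) D<sum))

  tight⇒first∉ : ∀ a js b → a ≢ b → AdjacentDistinct a js b →
    Tight a js b → a ∉ js
  tight⇒first∉ a js b a≢b ad tight a∈js with ∈-∃++ a∈js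
  ... | xs , ys , refl = <-irrefl _ (subst (D a b <_) (sym (trans tight (chainSum-++ a xs a ys b))) D<sum)
    where
    parts : AdjacentDistinct a xs a × AdjacentDistinct a ys b
    parts = adjacentDistinct-++⁻ a xs a ys b ad
    D<sum : D a b < chainSum R D a xs a + chainSum R D a ys b
    D<sum = ≤-<-trans (D≤chainSum a ys b a≢b (proj₂ parts)) (x<y+x _ (chainSum-pos a xs a (proj₁ parts)))

  tight⇒unique : ∀ a js b → a ≢ b → AdjacentDistinct a js b →
    Tight a js b → Unique (a ∷ js ++ b ∷ [])
  tight⇒unique a []       b a≢b _  _ = (a≢b ∷ []) ∷ [] ∷ []
  tight⇒unique a (j ∷ js) b a≢b ad tight =
    ¬Any⇒All¬ _ a∉rest ∷
    tight⇒unique j js b (tight⇒second≢last a j js b ad tight) (proj₂ ad) (tight-suffix a j js b a≢b ad tight)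
    where
    a∉rest : a ∉ (j ∷ js) ++ b ∷ []
    a∉rest a∈rest with ∈-++⁻ (j ∷ js) a∈rest
    ... | inj₁ a∈js       = tight⇒first∉ a (j ∷ js) b a≢b ad tight a∈js
    ... | inj₂ (here a≡b) = a≢b a≡b

  indecomposable-or-split : ∀ a b → a ≢ b →
    Indecomposable R D a b ⊎ ∃[ z ] (z ≢ a × z ≢ b × D a b ≡ D a z + D z b)
  indecomposable-or-split a b a≢b
    with any? (λ z → ¬? (z ≟ a) ×-dec ¬? (z ≟ b) ×-dec ¬? (D a b <? (D a z + D z b)))
  ... | yes (z , z≢a , z≢b , not-shorter) =
    inj₂ (z , z≢a , z≢b , ≤-antisym (D-tri a b z a≢b (≢-sym z≢b) (≢-sym z≢a)) (≮⇒≥ not-shorter))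
  ... | no no-split = inj₁ shorter
    where
    shorter : Indecomposable R D a b
    shorter z z≢a z≢b with D a b <? (D a z + D z b)
    ... | yes D<sum = D<sum
    ... | no D≮sum  = ⊥-elim (no-split (z , z≢a , z≢b , D≮sum))

  indecomposable⇒¬split : ∀ {a b z} → Indecomposable R D a b → z ≢ a → z ≢ b →
    ¬ (D a b ≡ D a z + D z b)
  indecomposable⇒¬split ind z≢a z≢b split = <-irrefl _ (subst (_ <_) (sym split) (ind _ z≢a z≢b))

  -- Termination measure for splitting a pair: a strictly shorter pair has fewer pairs below it.
  #below : List (Fin n × Fin n) → ℝ → ℕ
  #below []             r = 0
  #below ((i , j) ∷ ps) r with D i j <? r
  ... | yes _ = suc (#below ps r)
  ... | no  _ = #below ps r

  #below-mono : ∀ ps {r r'} → r ≤ r' → #below ps r ≤ℕ #below ps r'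
  #below-mono []             r≤r' = z≤n
  #below-mono ((i , j) ∷ ps) {r} {r'} r≤r' with D i j <? r | D i j <? r'
  ... | yes _   | yes _    = s≤s (#below-mono ps r≤r')
  ... | yes D<r | no  D≮r' = ⊥-elim (D≮r' (<-≤-trans D<r r≤r'))
  ... | no  _   | yes _    = ℕ.m≤n⇒m≤1+n (#below-mono ps r≤r')
  ... | no  _   | no  _    = #below-mono ps r≤r'

  #below-< : ∀ ps {i j r} → (i , j) ∈ ps → D i j < r → #below ps (D i j) <ℕ #below ps r
  #below-< ((i , j) ∷ ps) {r = r} (here refl) D<r with D i j <? D i j | D i j <? r
  ... | yes D<D | _        = ⊥-elim (<-irrefl _ D<D)
  ... | no  _   | no  D≮r  = ⊥-elim (D≮r D<r)
  ... | no  _   | yes _    = s≤s (#below-mono ps (inj₁ D<r))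
  #below-< ((k , l) ∷ ps) {i} {j} {r} (there ij∈ps) D<r with D k l <? D i j | D k l <? r
  ... | yes _   | yes _    = s≤s (#below-< ps ij∈ps D<r)
  ... | yes D<D | no  D≮r  = ⊥-elim (D≮r (<-trans D<D D<r))
  ... | no  _   | yes _    = ℕ.m≤n⇒m≤1+n (#below-< ps ij∈ps D<r)
  ... | no  _   | no  _    = #below-< ps ij∈ps D<r

  #shorter : ℝ → ℕ
  #shorter = #below (cartesianProduct (allFin n) (allFin n))

  #shorter-< : ∀ {i j r} → D i j < r → #shorter (D i j) <ℕ #shorter r
  #shorter-< {i} {j} = #below-< _ (∈-cartesianProduct⁺ (∈-allFin i) (∈-allFin j))

  Decomposition : Fin n → Fin n → Set
  Decomposition a b = ∃[ js ] (Tight a js b × AllIndecomposable R D a js b)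

  decomposition-join : ∀ {a z b} → D a b ≡ D a z + D z b →
    Decomposition a z → Decomposition z b → Decomposition a b
  decomposition-join {a} {z} {b} split (xs , eq₁ , ind₁) (ys , eq₂ , ind₂) =
    xs ++ z ∷ ys , eq , allIndecomposable-++ a xs z ys b ind₁ ind₂
    where
    open ≡-Reasoning
    eq : D a b ≡ chainSum R D a (xs ++ z ∷ ys) b
    eq = begin
      D a b                                         ≡⟨ split ⟩
      D a z + D z b                                 ≡⟨ cong₂ _+_ eq₁ eq₂ ⟩
      chainSum R D a xs z + chainSum R D z ys b     ≡⟨ sym (chainSum-++ a xs z ys b) ⟩
      chainSum R D a (xs ++ z ∷ ys) b               ∎

  decomposition-bounded : ∀ k a b → a ≢ b → #shorter (D a b) <ℕ k → Decomposition a b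
  decomposition-bounded (suc k) a b a≢b bound with indecomposable-or-split a b a≢b
  ... | inj₁ ind = [] , refl , a≢b , ind
  ... | inj₂ (z , z≢a , z≢b , split) =
    decomposition-join split
      (decomposition-bounded k a z (≢-sym z≢a) (fewer (subst (D a z <_) (sym split) (x<x+y _ (D-pos z b z≢b)))))
      (decomposition-bounded k z b z≢b (fewer (subst (D z b <_) (sym split) (x<y+x _ (D-pos a z (≢-sym z≢a))))))
    where
    fewer : ∀ {i j} → D i j < D a b → #shorter (D i j) <ℕ k
    fewer D<D = ℕ.<-≤-trans (#shorter-< D<D) (ℕ.≤-pred bound)

  decomposition : ∀ a b → a ≢ b → Decomposition a b
  decomposition a b a≢b = decomposition-bounded (suc (#shorter (D a b))) a b a≢b ℕ.≤-refl

  indecomposable-or-firstStep : ∀ a b → a ≢ b →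
    Indecomposable R D a b ⊎
    ∃[ v ] (a ≢ v × v ≢ b × Indecomposable R D a v × D a b ≡ D a v + D v b)
  indecomposable-or-firstStep a b a≢b with decomposition a b a≢b
  ... | []     , _     , (_ , ind)        = inj₁ ind
  ... | v ∷ js , tight , ind@(a≢v , indv , _) =
    inj₂ (v , a≢v , tight⇒second≢last a v js b ad tight , indv ,
          trans tight (cong (D a v +_) (sym (tight-suffix a v js b a≢b ad tight))))
    where
    ad : AdjacentDistinct a (v ∷ js) b
    ad = allIndecomposable⇒adjacentDistinct a (v ∷ js) b ind

  parity-cases : ∀ k → k % 2 ≡ 0 ⊎ k % 2 ≡ 1
  parity-cases zero          = inj₁ refl
  parity-cases (suc zero)    = inj₂ refl
  parity-cases (suc (suc k)) = parity-cases k

  minimal⇒indecomposable : ∀ {x y} → (∀ i j → i ≢ j → D x y ≤ D i j) → Indecomposable R D x y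
  minimal⇒indecomposable {x} minimal z z≢x z≢y =
    ≤-<-trans (minimal x z (≢-sym z≢x)) (x<x+y _ (D-pos z _ z≢y))

  InX⊎InY : ∀ x y → (∀ i j → i ≢ j → D x y ≤ D i j) → ∀ i → InX R D x y i ⊎ InY R D x i
  InX⊎InY x y minimal i with i ≟ x | i ≟ y
  ... | yes i≡x | _       = inj₁ (inj₁ i≡x)
  ... | no  i≢x | yes refl = inj₂ (i≢x , inj₁ (minimal⇒indecomposable minimal))
  ... | no  i≢x | no  i≢y with decomposition x i (≢-sym i≢x)
  ...   | js , tight , ind with parity-cases (length js)
  ...     | inj₁ even = inj₂ (i≢x , inj₂ (js , even , tight , ind))
  ...     | inj₂ odd  = inj₁ (inj₂ (i≢x , i≢y , js , odd , tight , ind))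

module Realisation (R : Reals) {n : ℕ} (D : Fin n → Fin n → Reals.ℝ R) (B : WeightedGraph R n)
                   (B-dist : ∀ i j → i ≢ j → IsDistance R B i j (D i j)) where
  open Reals R
  open RealOrder R
  open WeightedGraph B

  indecomposable⇒edge : ∀ {i j} → i ≢ j → Indecomposable R D i j → Edge i j
  indecomposable⇒edge {i} {j} i≢j ind with proj₁ (B-dist i j i≢j)
  ... | [] , (edge , _) , _ = edge
  ... | v ∷ vs , ((iv , walk) , (i≢v ∷ _) ∷ tail@(v≢rest ∷ _)) , weight =
    ⊥-elim (≤⇒≯ through-v (ind v (≢-sym i≢v) v≢j))
    where
    v≢j : v ≢ j
    v≢j = lookup v≢rest (∈-++⁺ʳ vs (here refl))
    through-v : D i v + D v j ≤ D i j
    through-v = subst (D i v + D v j ≤_) weight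
      (+-mono-≤ (proj₂ (B-dist i v i≢v) [] (iv , (i≢v ∷ []) ∷ [] ∷ []))
                (proj₂ (B-dist v j v≢j) vs (walk , tail)))

module Sides (R : Reals) {n : ℕ} (B : WeightedGraph R n) (X' Y' : Fin n → Set)
             (bipartite : BipartiteOn R B X' Y') where
  open WeightedGraph B

  Side : Bool → Fin n → Set
  Side true  = X'
  Side false = Y'

  side-disjoint : ∀ s {i} → Side s i → ¬ Side (not s) i
  side-disjoint true  i∈X i∈Y = proj₁ bipartite _ (i∈X , i∈Y)
  side-disjoint false i∈Y i∈X = proj₁ bipartite _ (i∈X , i∈Y)

  side-of : ∀ i → ∃[ s ] Side s i
  side-of i with proj₁ (proj₂ bipartite) i
  ... | inj₁ i∈X = true  , i∈X
  ... | inj₂ i∈Y = false , i∈Y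

  edge-flips-side : ∀ s {i j} → Edge i j → Side s i → Side (not s) j
  edge-flips-side s {i} {j} e i∈s with proj₂ (proj₂ bipartite) i j e
  edge-flips-side true  e i∈X | inj₁ (_ , j∈Y)   = j∈Y
  edge-flips-side true  e i∈X | inj₂ (i∈Y , _)   = ⊥-elim (side-disjoint true i∈X i∈Y)
  edge-flips-side false e i∈Y | inj₁ (i∈X , _)   = ⊥-elim (side-disjoint false i∈Y i∈X)
  edge-flips-side false e i∈Y | inj₂ (_ , j∈X)   = j∈X

  -- The side reached after the |js| + 1 edges of a walk a, js, b starting on side s.
  sideAfter : List (Fin n) → Bool → Bool
  sideAfter []       s = not s
  sideAfter (_ ∷ js) s = sideAfter js (not s)

  sideAfter-odd : ∀ js s → length js % 2 ≡ 1 → sideAfter js s ≡ s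
  sideAfter-odd (_ ∷ [])     s _   = not-involutive s
  sideAfter-odd (_ ∷ _ ∷ js) s odd = trans (cong (sideAfter js) (not-involutive s)) (sideAfter-odd js s odd)

  sideAfter-even : ∀ js s → length js % 2 ≡ 0 → sideAfter js s ≡ not s
  sideAfter-even []           s _    = refl
  sideAfter-even (_ ∷ _ ∷ js) s even = trans (cong (sideAfter js) (not-involutive s)) (sideAfter-even js s even)

  walk-side : ∀ a js b s → IsWalk R B a js b → Side s a → Side (sideAfter js s) b
  walk-side a []       b s e            a∈s = edge-flips-side s e a∈s
  walk-side a (j ∷ js) b s (e , walk)   a∈s = walk-side j js b (not s) walk (edge-flips-side s e a∈s)

module Necessity (R : Reals) {n : ℕ} (D : Fin n → Fin n → Reals.ℝ R)
                 (D-pos : Positive R D) (D-tri : TriangleInequalities R D)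
                 (B : WeightedGraph R n) (B-dist : ∀ i j → i ≢ j → IsDistance R B i j (D i j))
                 (X' Y' : Fin n → Set) (bipartite : BipartiteOn R B X' Y') where
  open Reals R
  open Chains R D D-pos D-tri
  open Realisation R D B B-dist
  open Sides R B X' Y' bipartite

  indecomposable-walk : ∀ a js b → AllIndecomposable R D a js b → IsWalk R B a js b
  indecomposable-walk a []       b (a≢b , ind)       = indecomposable⇒edge a≢b ind
  indecomposable-walk a (j ∷ js) b (a≢j , ind , rest) =
    indecomposable⇒edge a≢j ind , indecomposable-walk j js b rest

  same-side⇒midpoint : ∀ s {a b} → a ≢ b → Side s a → Side s b →
    ∃[ v ] (Side (not s) v × D a b ≡ D a v + D v b)
  same-side⇒midpoint s {a} {b} a≢b a∈s b∈s with indecomposable-or-firstStep a b a≢b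
  ... | inj₁ ind = ⊥-elim (side-disjoint s b∈s (edge-flips-side s (indecomposable⇒edge a≢b ind) a∈s))
  ... | inj₂ (v , a≢v , _ , ind , split) = v , edge-flips-side s (indecomposable⇒edge a≢v ind) a∈s , split

  module _ (x y : Fin n) (minimal : ∀ i j → i ≢ j → D x y ≤ D i j) where
    s₀ : Bool
    s₀ = proj₁ (side-of x)

    x∈s₀ : Side s₀ x
    x∈s₀ = proj₂ (side-of x)

    X⊆s₀ : ∀ {i} → InX R D x y i → Side s₀ i
    X⊆s₀ (inj₁ refl) = x∈s₀
    X⊆s₀ {i} (inj₂ (_ , _ , js , odd , _ , ind)) =
      subst (λ s → Side s i) (sideAfter-odd js s₀ odd) (walk-side x js i s₀ (indecomposable-walk x js i ind) x∈s₀)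

    Y⊆¬s₀ : ∀ {i} → InY R D x i → Side (not s₀) i
    Y⊆¬s₀ (i≢x , inj₁ ind) = edge-flips-side s₀ (indecomposable⇒edge (≢-sym i≢x) ind) x∈s₀
    Y⊆¬s₀ {i} (_ , inj₂ (js , even , _ , ind)) =
      subst (λ s → Side s i) (sideAfter-even js s₀ even) (walk-side x js i s₀ (indecomposable-walk x js i ind) x∈s₀)

    s₀⊆X : ∀ {i} → Side s₀ i → InX R D x y i
    s₀⊆X {i} i∈s₀ with InX⊎InY x y minimal i
    ... | inj₁ i∈X = i∈X
    ... | inj₂ i∈Y = ⊥-elim (side-disjoint s₀ i∈s₀ (Y⊆¬s₀ i∈Y))

    ¬s₀⊆Y : ∀ {i} → Side (not s₀) i → InY R D x i
    ¬s₀⊆Y {i} i∈¬s₀ with InX⊎InY x y minimal i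
    ... | inj₁ i∈X = ⊥-elim (side-disjoint s₀ (X⊆s₀ i∈X) i∈¬s₀)
    ... | inj₂ i∈Y = i∈Y

    conditions : Conditions R D x y
    conditions =
      (λ i (i∈X , i∈Y) → side-disjoint s₀ (X⊆s₀ i∈X) (Y⊆¬s₀ i∈Y)) ,
      (λ a b a≢b a∈X b∈X →
         let v , v∈¬s₀ , split = same-side⇒midpoint s₀ a≢b (X⊆s₀ a∈X) (X⊆s₀ b∈X)
         in v , ¬s₀⊆Y v∈¬s₀ , split) ,
      (λ a b a≢b a∈Y b∈Y →
         let v , v∈s₀ , split = same-side⇒midpoint (not s₀) a≢b (Y⊆¬s₀ a∈Y) (Y⊆¬s₀ b∈Y)
         in v , s₀⊆X (subst (λ s → Side s v) (not-involutive s₀) v∈s₀) , split)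

module Sufficiency (R : Reals) {n : ℕ} (D : Fin n → Fin n → Reals.ℝ R) (D-sym : Symmetric R D)
                   (D-pos : Positive R D) (D-tri : TriangleInequalities R D) where
  open Reals R
  open RealOrder R
  open Chains R D D-pos D-tri

  indecomposable-sym : ∀ {i j} → i ≢ j → Indecomposable R D i j → Indecomposable R D j i
  indecomposable-sym {i} {j} i≢j ind z z≢j z≢i =
    subst₂ _<_ (D-sym i j i≢j)
      (trans (cong₂ _+_ (D-sym i z (≢-sym z≢i)) (D-sym z j z≢j)) (+-comm _ _))
      (ind z z≢i z≢j)

  indecomposableGraph : WeightedGraph R n
  indecomposableGraph = record
    { Edge     = λ i j → i ≢ j × Indecomposable R D i j
    ; edge-sym = λ (i≢j , ind) → ≢-sym i≢j , indecomposable-sym i≢j ind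
    ; loopless = λ (i≢i , _) → i≢i refl
    ; w        = D
    ; w-sym    = λ (i≢j , _) → D-sym _ _ i≢j
    ; w-pos    = λ (i≢j , _) → D-pos _ _ i≢j
    }

  G : WeightedGraph R n
  G = indecomposableGraph

  walkWeight≡chainSum : ∀ a vs b → walkWeight R G a vs b ≡ chainSum R D a vs b
  walkWeight≡chainSum a []       b = refl
  walkWeight≡chainSum a (v ∷ vs) b = cong (D a v +_) (walkWeight≡chainSum v vs b)

  walk⇔allIndecomposable : ∀ a vs b →
    (AllIndecomposable R D a vs b → IsWalk R G a vs b) × (IsWalk R G a vs b → AllIndecomposable R D a vs b)
  walk⇔allIndecomposable a []       b = (λ edge → edge) , (λ edge → edge)
  walk⇔allIndecomposable a (v ∷ vs) b =
    (λ (a≢v , ind , rest) → (a≢v , ind) , proj₁ (walk⇔allIndecomposable v vs b) rest) ,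
    (λ ((a≢v , ind) , walk) → a≢v , ind , proj₂ (walk⇔allIndecomposable v vs b) walk)

  shortestPath : ∀ a b → a ≢ b → ∃[ vs ] (IsPath R G a vs b × walkWeight R G a vs b ≡ D a b)
  shortestPath a b a≢b with decomposition a b a≢b
  ... | js , tight , ind =
    js ,
    (proj₁ (walk⇔allIndecomposable a js b) ind ,
     tight⇒unique a js b a≢b (allIndecomposable⇒adjacentDistinct a js b ind) tight) ,
    trans (walkWeight≡chainSum a js b) (sym tight)

  distance : ∀ a b → a ≢ b → IsDistance R G a b (D a b)
  distance a b a≢b =
    shortestPath a b a≢b ,
    λ vs (walk , _) → subst (D a b ≤_) (sym (walkWeight≡chainSum a vs b))
      (D≤chainSum a vs b a≢b (allIndecomposable⇒adjacentDistinct a vs b (proj₂ (walk⇔allIndecomposable a vs b) walk)))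

  connected : Connected R G
  connected a b a≢b = let vs , path , _ = shortestPath a b a≢b in vs , path

  module _ (x y : Fin n) (minimal : ∀ i j → i ≢ j → D x y ≤ D i j) (conds : Conditions R D x y) where
    X∩Y=∅ : ∀ i → ¬ (InX R D x y i × InY R D x i)
    X∩Y=∅ = proj₁ conds

    -- An edge inside X (or Y) would be split by a vertex of the other class, which differs
    -- from both endpoints by (1).
    bipartite : BipartiteOn R G (InX R D x y) (InY R D x)
    bipartite = X∩Y=∅ , InX⊎InY x y minimal , edge-crosses
      where
      edge-crosses : ∀ i j → WeightedGraph.Edge G i j →
        (InX R D x y i × InY R D x j) ⊎ (InY R D x i × InX R D x y j)
      edge-crosses i j (i≢j , ind) with InX⊎InY x y minimal i | InX⊎InY x y minimal j
      ... | inj₁ i∈X | inj₂ j∈Y = inj₁ (i∈X , j∈Y)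
      ... | inj₂ i∈Y | inj₁ j∈X = inj₂ (i∈Y , j∈X)
      ... | inj₁ i∈X | inj₁ j∈X with proj₁ (proj₂ conds) i j i≢j i∈X j∈X
      ...   | z , z∈Y , split = ⊥-elim (indecomposable⇒¬split ind
                (λ { refl → X∩Y=∅ z (i∈X , z∈Y) }) (λ { refl → X∩Y=∅ z (j∈X , z∈Y) }) split)
      edge-crosses i j (i≢j , ind) | inj₂ i∈Y | inj₂ j∈Y with proj₂ (proj₂ conds) i j i≢j i∈Y j∈Y
      ...   | z , z∈X , split = ⊥-elim (indecomposable⇒¬split ind
                (λ { refl → X∩Y=∅ z (z∈X , i∈Y) }) (λ { refl → X∩Y=∅ z (z∈X , j∈Y) }) split)

    bigraphlike : Bigraphlike R D
    bigraphlike = InX R D x y , InY R D x , G , connected , bipartite , distance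

theorem5p4 : (R : Reals) → (n : ℕ) → (D : Fin n → Fin n → Reals.ℝ R) →
    Symmetric R D → Positive R D → TriangleInequalities R D →
    (x y : Fin n) → x ≢ y → (∀ i j → i ≢ j → Reals._≤_ R (D x y) (D i j)) →
    (Bigraphlike R D → Conditions R D x y) × (Conditions R D x y → Bigraphlike R D)
theorem5p4 R n D D-sym D-pos D-tri x y _ minimal =
  (λ (X' , Y' , B , _ , bipartite , B-dist) →
     Necessity.conditions R D D-pos D-tri B B-dist X' Y' bipartite x y minimal) ,
  Sufficiency.bigraphlike R D D-sym D-pos D-tri x y minimal
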